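{- In a $\{K_3,K_4\}$-decomposition of $K_{18}$ containing exactly $\alpha=13$ copies of $K_3$, there are $7$ vertices $w_1,\dots,w_7$ with $\alpha_{w_i}=4$ for all $i\in\{1,\dots,7\}$, and at least two of the copies of $K_3$ in the decomposition have all three of their vertices among $w_1,\dots,w_7$.
   Context: A $\{K_3,K_4\}$-decomposition of $K_v$ is a collection of subgraphs of $K_v$, each isomorphic to $K_3$ (triples) or $K_4$ (quadruples), whose edge sets partition $E(K_v)$. $\alpha$ is the number of copies of $K_3$ in the decomposition and, for a vertex $x$, $\alpha_x$ is the number of copies of $K_3$ containing $x$. -}

module Defs where

open import Data.Nat using (ℕ; _≤_)
open import Data.Fin using (Fin; _≟_)
open import Data.List using (List; []; _∷_; length; filter)
open import Data.List.Relation.Unary.All using (All)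
open import Data.List.Relation.Unary.All using (all?)
open import Data.List.Relation.Unary.Any using (any?)
open import Data.List.Membership.Propositional using (_∈_)
open import Data.Product using (_×_; Σ; ∃; _,_)
open import Relation.Nullary using (¬_; Dec; yes; no)
open import Relation.Nullary.Decidable using (_×-dec_)
open import Relation.Binary.PropositionalEquality using (_≡_; _≢_)
open import Data.Unit using (⊤; tt)
open import Data.Empty using (⊥)

-- A block of a {K3,K4}-decomposition of K_v: a complete subgraph on
-- 3 vertices (triple) or on 4 vertices (quadruple), given by its vertices.
data Block (v : ℕ) : Set where
  triple : Fin v → Fin v → Fin v → Block v
  quad   : Fin v → Fin v → Fin v → Fin v → Block v

verts : ∀ {v} → Block v → List (Fin v)
verts (triple a b c) = a ∷ b ∷ c ∷ []
verts (quad a b c d) = a ∷ b ∷ c ∷ d ∷ []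

WellFormed : ∀ {v} → Block v → Set
WellFormed (triple a b c) = a ≢ b × a ≢ c × b ≢ c
WellFormed (quad a b c d) = a ≢ b × a ≢ c × a ≢ d × b ≢ c × b ≢ d × c ≢ d

IsTriple : ∀ {v} → Block v → Set
IsTriple (triple _ _ _) = ⊤
IsTriple (quad _ _ _ _) = ⊥

isTriple? : ∀ {v} (B : Block v) → Dec (IsTriple B)
isTriple? (triple _ _ _) = yes tt
isTriple? (quad _ _ _ _) = no (λ ())

_∈?_ : ∀ {v} (x : Fin v) (xs : List (Fin v)) → Dec (x ∈ xs)
x ∈? xs = any? (x ≟_) xs

HasEdge : ∀ {v} → Fin v → Fin v → Block v → Set
HasEdge x y B = x ∈ verts B × y ∈ verts B

hasEdge? : ∀ {v} (x y : Fin v) (B : Block v) → Dec (HasEdge x y B)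
hasEdge? x y B = (x ∈? verts B) ×-dec (y ∈? verts B)

edgeCount : ∀ {v} → List (Block v) → Fin v → Fin v → ℕ
edgeCount D x y = length (filter (hasEdge? x y) D)

IsDecomposition : (v : ℕ) → List (Block v) → Set
IsDecomposition v D =
  All WellFormed D × (∀ (x y : Fin v) → x ≢ y → edgeCount D x y ≡ 1)

α : ∀ {v} → List (Block v) → ℕ
α D = length (filter isTriple? D)

tripleAt? : ∀ {v} (x : Fin v) (B : Block v) → Dec (IsTriple B × x ∈ verts B)
tripleAt? x B = isTriple? B ×-dec (x ∈? verts B)

αAt : ∀ {v} → List (Block v) → Fin v → ℕ
αAt D x = length (filter (tripleAt? x) D)

tripleInside? : ∀ {v} (ws : List (Fin v)) (B : Block v) →
                Dec (IsTriple B × All (_∈ ws) (verts B))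
tripleInside? ws B = isTriple? B ×-dec all? (_∈? ws) (verts B)

triplesInside : ∀ {v} → List (Block v) → List (Fin v) → ℕ
triplesInside D ws = length (filter (tripleInside? ws) D)

{-# OPTIONS --safe #-}
module Submission where

-- The triples and quadruples through a vertex x partition the other 17 vertices, so
-- 2α_x + 3q_x = 17 and α_x ∈ {1, 4, 7}.  If n_k vertices have α-value k, then
-- n₁ + n₄ + n₇ = 18 and n₁ + 4n₄ + 7n₇ = 3α = 39, so n₄ + 2n₇ = 7 and n₁ = 11 + n₇.
-- Suppose α_x = 7 and let j(B) be the number of vertices of α-value 1 in a block B.
-- Double counting gives Σ_triples j = n₁, Σ_quadruples j = 5n₁, Σ_B j² = n₁(n₁ + 5) and
-- Σ_{B ∋ x} j = n₁, and summing the blockwise inequalities (j − 3)(j − 4) ≥ 0 on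
-- quadruples and j(j − 1) ≥ 0 on triples, corrected for x, yields
-- 38n₁ ≤ n₁(n₁ + 5) + 248, false for n₁ ∈ {12, 13, 14}.  Hence n₇ = 0, n₄ = 7 and
-- n₁ = 11.  Each vertex of α-value 1 lies in exactly one triple, so at most 11 of the
-- 13 triples leave the 7 vertices of α-value 4.

open import Defs
open import Data.Bool.Base using (if_then_else_)
open import Data.Nat.Base using (ℕ; zero; suc; _+_; _*_; _≤_; _%_; z≤n; s≤s)
open import Data.Nat.Properties
  using (+-*-semiring; *-commutativeSemigroup; +-identityʳ; *-identityˡ; *-identityʳ; *-zeroʳ;
         +-assoc; *-comm; *-distribʳ-+; +-mono-≤; *-monoˡ-≤; m≤m+n; ≤-refl; <⇒≱; ≤ᵇ⇒≤;
         +-cancelˡ-≡; +-cancelʳ-≡; *-cancelʳ-≡; +-cancelʳ-≤; suc-injective; module ≤-Reasoning)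
  renaming (_≟_ to _≟ℕ_)
open import Data.Nat.DivMod using (m*n%n≡0)
open import Data.Nat.Tactic.RingSolver using (solve-∀)
open import Algebra.Properties.CommutativeSemigroup *-commutativeSemigroup using (x∙yz≈y∙xz)
open import Algebra.Properties.Semiring.Sum +-*-semiring
  using (sum; sum-syntax; ∑-distrib-+; ∑-comm; *-distribˡ-sum; *-distribʳ-sum;
         sum-cong-≗; sum-remove; sum-replicate-zero)
open import Data.Fin.Base using (Fin; zero; suc)
open import Data.Fin.Properties using (_≟_)
open import Data.List.Base using (List; []; _∷_; length; filter; lookup; tabulate; allFin)
open import Data.List.Properties using (tabulate-lookup)
open import Data.List.Relation.Unary.All as All using (All; []; _∷_; all?)
open import Data.List.Relation.Unary.All.Properties using (¬All⇒Any¬)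
open import Data.List.Relation.Unary.AllPairs using ([]; _∷_)
open import Data.List.Relation.Unary.Unique.Propositional using (Unique)
open import Data.List.Relation.Unary.Unique.Propositional.Properties using (filter⁺; allFin⁺)
open import Data.List.Membership.Propositional using (_∈_; _∉_; find)
open import Data.List.Membership.Propositional.Properties
  using (∈-filter⁺; ∈-filter⁻; ∈-allFin; ∈-lookup)
open import Data.Vec.Functional using (toList)
open import Data.Product using (_×_; Σ; _,_; proj₁; proj₂)
open import Data.Unit using (tt)
open import Data.Empty using (⊥; ⊥-elim)
open import Function.Base using (_∘_; case_of_)
open import Function.Definitions using (Injective)
open import Relation.Nullary using (¬_; Dec; yes; no; does)
open import Relation.Nullary.Decidable using (_×-dec_; _⊎-dec_)
open import Relation.Unary using (Pred; Decidable)
open import Relation.Binary.PropositionalEquality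
  using (_≡_; _≢_; refl; sym; trans; cong; cong₂; subst; subst₂; module ≡-Reasoning)

𝟙 : ∀ {p} {P : Set p} → Dec P → ℕ
𝟙 d = if does d then 1 else 0

module _ {p q} {P : Set p} {Q : Set q} where

  𝟙-× : (a : Dec P) (b : Dec Q) → 𝟙 (a ×-dec b) ≡ 𝟙 a * 𝟙 b
  𝟙-× (yes _) (yes _) = refl
  𝟙-× (yes _) (no _)  = refl
  𝟙-× (no _)  _       = refl

  𝟙-⊎ : (a : Dec P) (b : Dec Q) → ¬ (P × Q) → 𝟙 (a ⊎-dec b) ≡ 𝟙 a + 𝟙 b
  𝟙-⊎ (yes p) (yes q) ¬pq = ⊥-elim (¬pq (p , q))
  𝟙-⊎ (yes _) (no _)  _   = refl
  𝟙-⊎ (no _)  _       _   = refl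

  𝟙≤𝟙×+𝟙* : ∀ {w} (a : Dec P) (b : Dec Q) → (P → ¬ Q → 1 ≤ w) →
             𝟙 a ≤ 𝟙 (a ×-dec b) + 𝟙 a * w
  𝟙≤𝟙×+𝟙* (no _)  _       _ = z≤n
  𝟙≤𝟙×+𝟙* (yes _) (yes _) _ = s≤s z≤n
  𝟙≤𝟙×+𝟙* {w} (yes p) (no ¬q) h = subst (1 ≤_) (sym (+-identityʳ w)) (h p ¬q)

module _ {p} {P : Set p} where

  𝟙-yes : (d : Dec P) → P → 𝟙 d ≡ 1
  𝟙-yes (yes _) _ = refl
  𝟙-yes (no ¬p) p = ⊥-elim (¬p p)

  𝟙-no : (d : Dec P) → ¬ P → 𝟙 d ≡ 0
  𝟙-no (yes p) ¬p = ⊥-elim (¬p p)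
  𝟙-no (no _)  _  = refl

  𝟙≤1 : (d : Dec P) → 𝟙 d ≤ 1
  𝟙≤1 (yes _) = s≤s z≤n
  𝟙≤1 (no _)  = z≤n

  𝟙-idem : (d : Dec P) → 𝟙 d * 𝟙 d ≡ 𝟙 d
  𝟙-idem (yes _) = refl
  𝟙-idem (no _)  = refl

  𝟙*-cong : ∀ {m n} (d : Dec P) → (P → m ≡ n) → 𝟙 d * m ≡ 𝟙 d * n
  𝟙*-cong (yes p) m≡n = cong (1 *_) (m≡n p)
  𝟙*-cong (no _)  _   = refl

∑-δ : ∀ {n} (x : Fin n) (g : Fin n → ℕ) → ∑[ y < n ] (𝟙 (y ≟ x) * g y) ≡ g x
∑-δ {suc n} zero    g = trans (cong₂ _+_ (+-identityʳ (g zero)) (sum-replicate-zero n)) (+-identityʳ (g zero))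
∑-δ {suc n} (suc x) g = ∑-δ x (g ∘ suc)

∑-𝟙≟ : ∀ {n} (x : Fin n) → ∑[ y < n ] 𝟙 (y ≟ x) ≡ 1
∑-𝟙≟ {n} x = trans (sum-cong-≗ (λ y → sym (*-identityʳ (𝟙 (y ≟ x))))) (∑-δ x (λ _ → 1))

∑-const : ∀ n c → ∑[ y < n ] c ≡ n * c
∑-const zero    c = refl
∑-const (suc n) c = cong (c +_) (∑-const n c)

∑-linear : ∀ {n} (f g : Fin n → ℕ) a b →
           ∑[ i < n ] (f i * a + g i * b) ≡ sum f * a + sum g * b
∑-linear f g a b = trans (∑-distrib-+ (λ i → f i * a) (λ i → g i * b))
                         (sym (cong₂ _+_ (*-distribʳ-sum a f) (*-distribʳ-sum b g)))

∑-mono-≤ : ∀ {n} {f g : Fin n → ℕ} → (∀ i → f i ≤ g i) → sum f ≤ sum g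
∑-mono-≤ {zero}  _   = z≤n
∑-mono-≤ {suc n} f≤g = +-mono-≤ (f≤g zero) (∑-mono-≤ (f≤g ∘ suc))

term≤∑ : ∀ {n} (f : Fin n → ℕ) i → f i ≤ sum f
term≤∑ {zero}  f ()
term≤∑ {suc n} f i = subst (f i ≤_) (sym (sum-remove f)) (m≤m+n (f i) _)

∑-𝟙*-cong : ∀ {n p} {P : Pred (Fin n) p} (P? : Decidable P) {f g : Fin n → ℕ} →
            (∀ y → P y → f y ≡ g y) → ∑[ y < n ] (𝟙 (P? y) * f y) ≡ ∑[ y < n ] (𝟙 (P? y) * g y)
∑-𝟙*-cong P? f≡g = sum-cong-≗ (λ y → 𝟙*-cong (P? y) (f≡g y))

module _ {a p} {A : Set a} {P : Pred A p} (P? : Decidable P) where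

  length-filter-tabulate : ∀ {n} (f : Fin n → A) →
                           length (filter P? (tabulate f)) ≡ ∑[ i < n ] 𝟙 (P? (f i))
  length-filter-tabulate {zero}  f = refl
  length-filter-tabulate {suc n} f with P? (f zero)
  ... | yes _ = cong suc (length-filter-tabulate (f ∘ suc))
  ... | no _  = length-filter-tabulate (f ∘ suc)

  length-filter-lookup : ∀ (xs : List A) →
                         length (filter P? xs) ≡ ∑[ i < length xs ] 𝟙 (P? (lookup xs i))
  length-filter-lookup xs =
    trans (cong (length ∘ filter P?) (sym (tabulate-lookup xs))) (length-filter-tabulate (lookup xs))

∑-∈-unique : ∀ {n} {xs : List (Fin n)} → Unique xs → ∑[ y < n ] 𝟙 (y ∈? xs) ≡ length xs
∑-∈-unique {n} {[]}     []           = sum-replicate-zero n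
∑-∈-unique {n} {x ∷ xs} (x∉xs ∷ !xs) = begin
  ∑[ y < n ] 𝟙 (y ∈? (x ∷ xs))                  ≡⟨ sum-cong-≗ split ⟩
  ∑[ y < n ] (𝟙 (y ≟ x) + 𝟙 (y ∈? xs))          ≡⟨ ∑-distrib-+ (λ y → 𝟙 (y ≟ x)) (λ y → 𝟙 (y ∈? xs)) ⟩
  ∑[ y < n ] 𝟙 (y ≟ x) + ∑[ y < n ] 𝟙 (y ∈? xs) ≡⟨ cong₂ _+_ (∑-𝟙≟ x) (∑-∈-unique !xs) ⟩
  suc (length xs)                               ∎
  where
  open ≡-Reasoning
  split : ∀ y → 𝟙 (y ∈? (x ∷ xs)) ≡ 𝟙 (y ≟ x) + 𝟙 (y ∈? xs)
  split y = 𝟙-⊎ (y ≟ x) (y ∈? xs) λ where (refl , y∈xs) → All.lookup x∉xs y∈xs refl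

lookup-injective : ∀ {a} {A : Set a} {xs : List A} → Unique xs → Injective _≡_ _≡_ (lookup xs)
lookup-injective {xs = _ ∷ _} _            {zero}  {zero}  _  = refl
lookup-injective {xs = _ ∷ _} (x∉xs ∷ _)   {zero}  {suc j} eq = ⊥-elim (All.lookup x∉xs (∈-lookup j) eq)
lookup-injective {xs = _ ∷ _} (x∉xs ∷ _)   {suc i} {zero}  eq = ⊥-elim (All.lookup x∉xs (∈-lookup i) (sym eq))
lookup-injective {xs = _ ∷ _} (_ ∷ !xs)    {suc i} {suc j} eq = cong suc (lookup-injective !xs eq)

injection-from-list : ∀ {a} {A : Set a} {n} (xs : List A) → length xs ≡ n → Unique xs →
                      Σ (Fin n → A) λ w → Injective _≡_ _≡_ w × (∀ i → w i ∈ xs) × toList w ≡ xs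
injection-from-list xs refl !xs = lookup xs , lookup-injective !xs , ∈-lookup , tabulate-lookup xs

𝟙triple 𝟙quad : ∀ {v} → Block v → ℕ
𝟙triple b = 𝟙 (isTriple? b)
𝟙quad (triple _ _ _) = 0
𝟙quad (quad _ _ _ _) = 1

𝟙triple+𝟙quad : ∀ {v} (b : Block v) → 𝟙triple b + 𝟙quad b ≡ 1
𝟙triple+𝟙quad (triple _ _ _) = refl
𝟙triple+𝟙quad (quad _ _ _ _) = refl

length-verts : ∀ {v} (b : Block v) → length (verts b) ≡ 𝟙triple b * 3 + 𝟙quad b * 4
length-verts (triple _ _ _) = refl
length-verts (quad _ _ _ _) = refl

𝟙triple*length : ∀ {v} (b : Block v) → 𝟙triple b * length (verts b) ≡ 𝟙triple b * 3
𝟙triple*length (triple _ _ _) = refl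
𝟙triple*length (quad _ _ _ _) = refl

𝟙quad*length : ∀ {v} (b : Block v) → 𝟙quad b * length (verts b) ≡ 𝟙quad b * 4
𝟙quad*length (triple _ _ _) = refl
𝟙quad*length (quad _ _ _ _) = refl

verts-unique : ∀ {v} (b : Block v) → WellFormed b → Unique (verts b)
verts-unique (triple _ _ _) (ab , ac , bc) = (ab ∷ ac ∷ []) ∷ (bc ∷ []) ∷ [] ∷ []
verts-unique (quad _ _ _ _) (ab , ac , ad , bc , bd , cd) =
  (ab ∷ ac ∷ ad ∷ []) ∷ (bc ∷ bd ∷ []) ∷ (cd ∷ []) ∷ [] ∷ []

-- Double counting in a family of blocks

module Design {v m : ℕ} (B : Fin m → Block v) where

  χ : Fin m → Fin v → ℕ
  χ i y = 𝟙 (y ∈? verts (B i))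

  weight : (Fin v → ℕ) → Fin m → ℕ
  weight g i = ∑[ y < v ] (g y * χ i y)

  degree : (Fin m → ℕ) → Fin v → ℕ
  degree f y = ∑[ i < m ] (f i * χ i y)

  size : Fin m → ℕ
  size = weight (λ _ → 1)

  r : Fin v → ℕ
  r y = ∑[ i < m ] χ i y

  pairs : Fin v → Fin v → ℕ
  pairs x = degree (λ i → χ i x)

  𝟙T 𝟙Q : Fin m → ℕ
  𝟙T i = 𝟙triple (B i)
  𝟙Q i = 𝟙quad (B i)

  ∑-weight : ∀ f g → ∑[ i < m ] (f i * weight g i) ≡ ∑[ y < v ] (g y * degree f y)
  ∑-weight f g = begin
    ∑[ i < m ] (f i * weight g i)
      ≡⟨ sum-cong-≗ (λ i → *-distribˡ-sum (f i) (λ y → g y * χ i y)) ⟩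
    ∑[ i < m ] ∑[ y < v ] (f i * (g y * χ i y))
      ≡⟨ ∑-comm (λ i y → f i * (g y * χ i y)) ⟩
    ∑[ y < v ] ∑[ i < m ] (f i * (g y * χ i y))
      ≡⟨ sum-cong-≗ (λ y → sum-cong-≗ (λ i → x∙yz≈y∙xz (f i) (g y) (χ i y))) ⟩
    ∑[ y < v ] ∑[ i < m ] (g y * (f i * χ i y))
      ≡⟨ sum-cong-≗ (λ y → sym (*-distribˡ-sum (g y) (λ i → f i * χ i y))) ⟩
    ∑[ y < v ] (g y * degree f y)
      ∎
    where open ≡-Reasoning

  degree-linear : ∀ f g a b y → degree (λ i → f i * a + g i * b) y ≡ degree f y * a + degree g y * b
  degree-linear f g a b y =
    trans (sum-cong-≗ (λ i → rearrange (f i) (g i) (χ i y) a b))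
          (∑-linear (λ i → f i * χ i y) (λ i → g i * χ i y) a b)
    where
    rearrange : ∀ p q c a b → (p * a + q * b) * c ≡ p * c * a + q * c * b
    rearrange = solve-∀

  weight-+ : ∀ g h i → weight (λ y → g y + h y) i ≡ weight g i + weight h i
  weight-+ g h i = trans (sum-cong-≗ (λ y → *-distribʳ-+ (χ i y) (g y) (h y)))
                         (∑-distrib-+ (λ y → g y * χ i y) (λ y → h y * χ i y))

  weight-mono : ∀ {g h} i → (∀ y → g y ≤ h y) → weight g i ≤ weight h i
  weight-mono i g≤h = ∑-mono-≤ (λ y → *-monoˡ-≤ (χ i y) (g≤h y))

  weight-≥ : ∀ g {i y} → y ∈ verts (B i) → g y ≤ weight g i
  weight-≥ g {i} {y} y∈ = subst (_≤ weight g i) g*χ≡g (term≤∑ (λ z → g z * χ i z) y)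
    where
    g*χ≡g : g y * χ i y ≡ g y
    g*χ≡g = trans (cong (g y *_) (𝟙-yes (y ∈? verts (B i)) y∈)) (*-identityʳ (g y))

  pairs-diag : ∀ x → pairs x x ≡ r x
  pairs-diag x = sum-cong-≗ (λ i → 𝟙-idem (x ∈? verts (B i)))

  r-split : ∀ x → r x ≡ degree 𝟙T x + degree 𝟙Q x
  r-split x = trans (sum-cong-≗ split) (∑-distrib-+ (λ i → 𝟙T i * χ i x) (λ i → 𝟙Q i * χ i x))
    where
    split : ∀ i → χ i x ≡ 𝟙T i * χ i x + 𝟙Q i * χ i x
    split i = sym (trans (sym (*-distribʳ-+ (χ i x) (𝟙T i) (𝟙Q i)))
                         (trans (cong (_* χ i x) (𝟙triple+𝟙quad (B i))) (*-identityˡ (χ i x))))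

  module LinearSpace (once : ∀ {x y} → x ≢ y → pairs x y ≡ 1) where

    -- The blocks through x cover every other point once and x itself r x times.
    ∑-through : ∀ x g → degree (weight g) x + g x ≡ ∑[ y < v ] g y + r x * g x
    ∑-through x g = begin
      degree (weight g) x + g x
        ≡⟨ cong₂ _+_ (trans (sum-cong-≗ (λ i → *-comm (weight g i) (χ i x))) (∑-weight (λ i → χ i x) g))
                     (sym (∑-δ x g)) ⟩
      ∑[ y < v ] (g y * pairs x y) + ∑[ y < v ] (𝟙 (y ≟ x) * g y)
        ≡⟨ sym (∑-distrib-+ (λ y → g y * pairs x y) (λ y → 𝟙 (y ≟ x) * g y)) ⟩
      ∑[ y < v ] (g y * pairs x y + 𝟙 (y ≟ x) * g y)
        ≡⟨ sum-cong-≗ pointwise ⟩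
      ∑[ y < v ] (g y + 𝟙 (y ≟ x) * (r x * g y))
        ≡⟨ ∑-distrib-+ g (λ y → 𝟙 (y ≟ x) * (r x * g y)) ⟩
      ∑[ y < v ] g y + ∑[ y < v ] (𝟙 (y ≟ x) * (r x * g y))
        ≡⟨ cong (sum g +_) (∑-δ x (λ y → r x * g y)) ⟩
      ∑[ y < v ] g y + r x * g x
        ∎
      where
      open ≡-Reasoning
      swap : ∀ a b → a * b + 1 * a ≡ a + 1 * (b * a)
      swap = solve-∀
      pointwise : ∀ y → g y * pairs x y + 𝟙 (y ≟ x) * g y ≡ g y + 𝟙 (y ≟ x) * (r x * g y)
      pointwise y with y ≟ x
      ... | yes refl = trans (cong (λ k → g y * k + 1 * g y) (pairs-diag y)) (swap (g y) (r y))
      ... | no y≢x   = cong (_+ 0) (trans (cong (g y *_) (once (y≢x ∘ sym))) (*-identityʳ (g y)))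

  module Decomposition (wf : ∀ i → WellFormed (B i)) (once : ∀ {x y} → x ≢ y → pairs x y ≡ 1) where

    open LinearSpace once

    size≡length : ∀ i → size i ≡ length (verts (B i))
    size≡length i = trans (sum-cong-≗ (λ y → *-identityˡ (χ i y))) (∑-∈-unique (verts-unique (B i) (wf i)))

    ∑-size : ∀ f → ∑[ i < m ] (f i * size i) ≡ ∑[ y < v ] degree f y
    ∑-size f = trans (∑-weight f (λ _ → 1)) (sum-cong-≗ (λ y → *-identityˡ (degree f y)))

    ∑-degree-𝟙T : ∑[ y < v ] degree 𝟙T y ≡ sum 𝟙T * 3
    ∑-degree-𝟙T = trans (sym (∑-size 𝟙T)) (trans (sum-cong-≗ 𝟙T*size) (sym (*-distribʳ-sum 3 𝟙T)))
      where
      𝟙T*size : ∀ i → 𝟙T i * size i ≡ 𝟙T i * 3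
      𝟙T*size i = trans (cong (𝟙T i *_) (size≡length i)) (𝟙triple*length (B i))

    ∑-degree-𝟙Q : ∑[ y < v ] degree 𝟙Q y ≡ sum 𝟙Q * 4
    ∑-degree-𝟙Q = trans (sym (∑-size 𝟙Q)) (trans (sum-cong-≗ 𝟙Q*size) (sym (*-distribʳ-sum 4 𝟙Q)))
      where
      𝟙Q*size : ∀ i → 𝟙Q i * size i ≡ 𝟙Q i * 4
      𝟙Q*size i = trans (cong (𝟙Q i *_) (size≡length i)) (𝟙quad*length (B i))

    degree-equation : ∀ x → suc (degree 𝟙T x * 2 + degree 𝟙Q x * 3) ≡ v
    degree-equation x = +-cancelʳ-≡ (t + q) _ _ (begin
      suc (t * 2 + q * 3) + (t + q) ≡⟨ rearrange t q ⟩
      t * 3 + q * 4 + 1             ≡⟨ cong (_+ 1) (sym degree-size) ⟩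
      degree size x + 1             ≡⟨ ∑-through x (λ _ → 1) ⟩
      ∑[ y < v ] 1 + r x * 1        ≡⟨ cong₂ _+_ (trans (∑-const v 1) (*-identityʳ v))
                                                 (trans (*-identityʳ (r x)) (r-split x)) ⟩
      v + (t + q)                   ∎)
      where
      open ≡-Reasoning
      t q : ℕ
      t = degree 𝟙T x
      q = degree 𝟙Q x
      rearrange : ∀ a b → suc (a * 2 + b * 3) + (a + b) ≡ a * 3 + b * 4 + 1
      rearrange = solve-∀
      degree-size : degree size x ≡ t * 3 + q * 4
      degree-size = trans (sum-cong-≗ (λ i → cong (_* χ i x) (trans (size≡length i) (length-verts (B i)))))
                          (degree-linear 𝟙T 𝟙Q 3 4 x)

    edge-count : v + (sum 𝟙T * 6 + sum 𝟙Q * 12) ≡ v * v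
    edge-count = begin
      v + (sum 𝟙T * 6 + sum 𝟙Q * 12)
        ≡⟨ cong (v +_) (rearrange (sum 𝟙T) (sum 𝟙Q)) ⟩
      v + (sum 𝟙T * 3 * 2 + sum 𝟙Q * 4 * 3)
        ≡⟨ cong (v +_) (sym (cong₂ (λ a b → a * 2 + b * 3) ∑-degree-𝟙T ∑-degree-𝟙Q)) ⟩
      v + (sum (degree 𝟙T) * 2 + sum (degree 𝟙Q) * 3)
        ≡⟨ cong (v +_) (sym (∑-linear (degree 𝟙T) (degree 𝟙Q) 2 3)) ⟩
      v + ∑[ y < v ] 2α+3q y
        ≡⟨ cong (_+ ∑[ y < v ] 2α+3q y) (sym (trans (∑-const v 1) (*-identityʳ v))) ⟩
      ∑[ y < v ] 1 + ∑[ y < v ] 2α+3q y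
        ≡⟨ sym (∑-distrib-+ (λ _ → 1) 2α+3q) ⟩
      ∑[ y < v ] suc (2α+3q y)
        ≡⟨ sum-cong-≗ degree-equation ⟩
      ∑[ y < v ] v
        ≡⟨ ∑-const v v ⟩
      v * v
        ∎
      where
      open ≡-Reasoning
      2α+3q : Fin v → ℕ
      2α+3q y = degree 𝟙T y * 2 + degree 𝟙Q y * 3
      rearrange : ∀ a b → a * 6 + b * 12 ≡ a * 3 * 2 + b * 4 * 3
      rearrange = solve-∀

-- Arithmetic for K₁₈

-- The solutions (α, q) of 2α + 3q = 17.
data Profile : ℕ → ℕ → Set where
  one   : Profile 1 5
  four  : Profile 4 3
  seven : Profile 7 1

multiple-of-3 : ∀ k q {n} → k + q * 3 ≡ k + n → n % 3 ≡ 0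
multiple-of-3 k q e = trans (cong (_% 3) (sym (+-cancelˡ-≡ k _ _ e))) (m*n%n≡0 q 3)

profile : ∀ a {q} → a * 2 + q * 3 ≡ 17 → Profile a q
profile 1 {q} e with *-cancelʳ-≡ q 5 3 (+-cancelˡ-≡ 2 _ _ e)
... | refl = one
profile 4 {q} e with *-cancelʳ-≡ q 3 3 (+-cancelˡ-≡ 8 _ _ e)
... | refl = four
profile 7 {q} e with *-cancelʳ-≡ q 1 3 (+-cancelˡ-≡ 14 _ _ e)
... | refl = seven
profile 0 {q} e = case multiple-of-3 0 q e of λ ()
profile 2 {q} e = case multiple-of-3 4 q e of λ ()
profile 3 {q} e = case multiple-of-3 6 q e of λ ()
profile 5 {q} e = case multiple-of-3 10 q e of λ ()
profile 6 {q} e = case multiple-of-3 12 q e of λ ()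
profile 8 {q} e = case multiple-of-3 16 q e of λ ()
profile (suc (suc (suc (suc (suc (suc (suc (suc (suc _))))))))) ()

profile-partition : ∀ {a q} → Profile a q → 𝟙 (a ≟ℕ 1) + 𝟙 (a ≟ℕ 4) + 𝟙 (a ≟ℕ 7) ≡ 1
profile-partition one   = refl
profile-partition four  = refl
profile-partition seven = refl

profile-value : ∀ {a q} → Profile a q → 𝟙 (a ≟ℕ 1) + 𝟙 (a ≟ℕ 4) * 4 + 𝟙 (a ≟ℕ 7) * 7 ≡ a
profile-value one   = refl
profile-value four  = refl
profile-value seven = refl

profile-1 : ∀ {q} → Profile 1 q → q ≡ 5
profile-1 one = refl

profile-7 : ∀ {q} → Profile 7 q → q ≡ 1
profile-7 seven = refl

profile-≢4-≢7⇒≡1 : ∀ {a q} → Profile a q → a ≢ 4 → a ≢ 7 → a ≡ 1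
profile-≢4-≢7⇒≡1 one   _  _  = refl
profile-≢4-≢7⇒≡1 four  ≢4 _  = ⊥-elim (≢4 refl)
profile-≢4-≢7⇒≡1 seven _  ≢7 = ⊥-elim (≢7 refl)

vertex-counts : ∀ {s a b} → s + a + b ≡ 18 → s + a * 4 + b * 7 ≡ 39 → b * 2 + a ≡ 7 × s ≡ 11 + b
vertex-counts {s} {a} {b} e₁ e₂ = b*2+a≡7 , +-cancelʳ-≡ 7 s (11 + b) (begin
  s + 7           ≡⟨ cong (s +_) (sym b*2+a≡7) ⟩
  s + (b * 2 + a) ≡⟨ rearrange₂ s a b ⟩
  s + a + b + b   ≡⟨ cong (_+ b) e₁ ⟩
  18 + b          ≡⟨ rearrange₃ b ⟩
  11 + b + 7      ∎)
  where
  open ≡-Reasoning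
  rearrange₁ : ∀ s a b → (b * 2 + a) * 3 + (s + a + b) ≡ s + a * 4 + b * 7
  rearrange₁ = solve-∀
  rearrange₂ : ∀ s a b → s + (b * 2 + a) ≡ s + a + b + b
  rearrange₂ = solve-∀
  rearrange₃ : ∀ b → 18 + b ≡ 11 + b + 7
  rearrange₃ = solve-∀
  b*2+a≡7 : b * 2 + a ≡ 7
  b*2+a≡7 = *-cancelʳ-≡ (b * 2 + a) 7 3 (+-cancelʳ-≡ 18 _ 21 (begin
    (b * 2 + a) * 3 + 18           ≡⟨ cong ((b * 2 + a) * 3 +_) (sym e₁) ⟩
    (b * 2 + a) * 3 + (s + a + b)  ≡⟨ rearrange₁ s a b ⟩
    s + a * 4 + b * 7              ≡⟨ e₂ ⟩
    39                             ∎))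

quadratic-bound-fails : ∀ {s a b} → b * 2 + a ≡ 7 → s ≡ 11 + b → 1 ≤ b → ¬ (s * 38 ≤ s * (s + 5) + 248)
quadratic-bound-fails {b = 0}                       _    _    ()
quadratic-bound-fails {b = 1}                       refl refl _ = <⇒≱ (≤ᵇ⇒≤ _ _ tt)
quadratic-bound-fails {b = 2}                       refl refl _ = <⇒≱ (≤ᵇ⇒≤ _ _ tt)
quadratic-bound-fails {b = 3}                       refl refl _ = <⇒≱ (≤ᵇ⇒≤ _ _ tt)
quadratic-bound-fails {b = suc (suc (suc (suc _)))} ()   _    _

-- For m = 0 these are (j − 3)(j − 4) ≥ 0 on a quadruple and j(j − 1) ≥ 0 on a triple.
block-bound : ∀ {v} (b : Block v) j m → j + m ≤ length (verts b) →
              𝟙triple b * j + 𝟙quad b * j * 7 + j * m * 2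
                ≤ j * j + 𝟙quad b * 12 + (𝟙triple b * 2 + 𝟙quad b * 6) * m
block-bound (triple _ _ _) 0 _ _ = z≤n
block-bound (triple _ _ _) 1 0 _ = ≤ᵇ⇒≤ _ _ tt
block-bound (triple _ _ _) 1 1 _ = ≤ᵇ⇒≤ _ _ tt
block-bound (triple _ _ _) 1 2 _ = ≤ᵇ⇒≤ _ _ tt
block-bound (triple _ _ _) 2 0 _ = ≤ᵇ⇒≤ _ _ tt
block-bound (triple _ _ _) 2 1 _ = ≤ᵇ⇒≤ _ _ tt
block-bound (triple _ _ _) 3 0 _ = ≤ᵇ⇒≤ _ _ tt
block-bound (triple _ _ _) 1 (suc (suc (suc _))) (s≤s (s≤s (s≤s ())))
block-bound (triple _ _ _) 2 (suc (suc _))       (s≤s (s≤s (s≤s ())))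
block-bound (triple _ _ _) 3 (suc _)             (s≤s (s≤s (s≤s ())))
block-bound (triple _ _ _) (suc (suc (suc (suc _)))) _ (s≤s (s≤s (s≤s ())))
block-bound (quad _ _ _ _) 0 _ _ = z≤n
block-bound (quad _ _ _ _) 1 0 _ = ≤ᵇ⇒≤ _ _ tt
block-bound (quad _ _ _ _) 1 1 _ = ≤ᵇ⇒≤ _ _ tt
block-bound (quad _ _ _ _) 1 2 _ = ≤ᵇ⇒≤ _ _ tt
block-bound (quad _ _ _ _) 1 3 _ = ≤ᵇ⇒≤ _ _ tt
block-bound (quad _ _ _ _) 2 0 _ = ≤ᵇ⇒≤ _ _ tt
block-bound (quad _ _ _ _) 2 1 _ = ≤ᵇ⇒≤ _ _ tt
block-bound (quad _ _ _ _) 2 2 _ = ≤ᵇ⇒≤ _ _ tt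
block-bound (quad _ _ _ _) 3 0 _ = ≤ᵇ⇒≤ _ _ tt
block-bound (quad _ _ _ _) 3 1 _ = ≤ᵇ⇒≤ _ _ tt
block-bound (quad _ _ _ _) 4 0 _ = ≤ᵇ⇒≤ _ _ tt
block-bound (quad _ _ _ _) 1 (suc (suc (suc (suc _)))) (s≤s (s≤s (s≤s (s≤s ()))))
block-bound (quad _ _ _ _) 2 (suc (suc (suc _)))       (s≤s (s≤s (s≤s (s≤s ()))))
block-bound (quad _ _ _ _) 3 (suc (suc _))             (s≤s (s≤s (s≤s (s≤s ()))))
block-bound (quad _ _ _ _) 4 (suc _)                   (s≤s (s≤s (s≤s (s≤s ()))))
block-bound (quad _ _ _ _) (suc (suc (suc (suc (suc _))))) _ (s≤s (s≤s (s≤s (s≤s ()))))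

-- Decompositions of K₁₈ with 13 triples

module Decomposition₁₈ (D : List (Block 18)) (wf : All WellFormed D)
                       (E : ∀ x y → x ≢ y → edgeCount D x y ≡ 1) (α≡13 : α D ≡ 13) where

  open Design (lookup D)

  once : ∀ {x y} → x ≢ y → pairs x y ≡ 1
  once {x} {y} x≢y = trans (sym edgeCount≡pairs) (E x y x≢y)
    where
    edgeCount≡pairs : edgeCount D x y ≡ pairs x y
    edgeCount≡pairs = trans (length-filter-lookup (hasEdge? x y) D)
                            (sum-cong-≗ (λ i → 𝟙-× (x ∈? verts (lookup D i)) (y ∈? verts (lookup D i))))

  open LinearSpace once
  open Decomposition (λ i → All.lookup wf (∈-lookup i)) once

  αAt≡degree : ∀ x → αAt D x ≡ degree 𝟙T x
  αAt≡degree x = trans (length-filter-lookup (tripleAt? x) D)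
                       (sum-cong-≗ (λ i → 𝟙-× (isTriple? (lookup D i)) (x ∈? verts (lookup D i))))

  ∑𝟙T≡13 : sum 𝟙T ≡ 13
  ∑𝟙T≡13 = trans (sym (length-filter-lookup isTriple? D)) α≡13

  ∑𝟙Q*12≡228 : sum 𝟙Q * 12 ≡ 228
  ∑𝟙Q*12≡228 = +-cancelˡ-≡ 96 _ 228 (subst (λ t → 18 + (t * 6 + sum 𝟙Q * 12) ≡ 18 * 18) ∑𝟙T≡13 edge-count)

  profileAt : ∀ x → Profile (αAt D x) (degree 𝟙Q x)
  profileAt x = profile (αAt D x) (suc-injective
    (trans (cong (λ a → suc (a * 2 + degree 𝟙Q x * 3)) (αAt≡degree x)) (degree-equation x)))

  c : ℕ → Fin 18 → ℕ
  c k y = 𝟙 (αAt D y ≟ℕ k)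

  n₁ n₄ n₇ : ℕ
  n₁ = sum (c 1)
  n₄ = sum (c 4)
  n₇ = sum (c 7)

  n₁+n₄+n₇≡18 : n₁ + n₄ + n₇ ≡ 18
  n₁+n₄+n₇≡18 = begin
    n₁ + n₄ + n₇                       ≡⟨ cong (_+ n₇) (sym (∑-distrib-+ (c 1) (c 4))) ⟩
    ∑[ y < 18 ] (c 1 y + c 4 y) + n₇   ≡⟨ sym (∑-distrib-+ (λ y → c 1 y + c 4 y) (c 7)) ⟩
    ∑[ y < 18 ] (c 1 y + c 4 y + c 7 y) ≡⟨ sum-cong-≗ (profile-partition ∘ profileAt) ⟩
    18                                 ∎
    where open ≡-Reasoning

  n₁+n₄*4+n₇*7≡39 : n₁ + n₄ * 4 + n₇ * 7 ≡ 39
  n₁+n₄*4+n₇*7≡39 = begin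
    n₁ + n₄ * 4 + n₇ * 7
      ≡⟨ cong₂ (λ a b → n₁ + a + b) (*-distribʳ-sum 4 (c 4)) (*-distribʳ-sum 7 (c 7)) ⟩
    n₁ + ∑[ y < 18 ] (c 4 y * 4) + ∑[ y < 18 ] (c 7 y * 7)
      ≡⟨ cong (_+ ∑[ y < 18 ] (c 7 y * 7)) (sym (∑-distrib-+ (c 1) (λ y → c 4 y * 4))) ⟩
    ∑[ y < 18 ] (c 1 y + c 4 y * 4) + ∑[ y < 18 ] (c 7 y * 7)
      ≡⟨ sym (∑-distrib-+ (λ y → c 1 y + c 4 y * 4) (λ y → c 7 y * 7)) ⟩
    ∑[ y < 18 ] (c 1 y + c 4 y * 4 + c 7 y * 7)
      ≡⟨ sum-cong-≗ (λ y → trans (profile-value (profileAt y)) (αAt≡degree y)) ⟩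
    ∑[ y < 18 ] degree 𝟙T y
      ≡⟨ ∑-degree-𝟙T ⟩
    sum 𝟙T * 3
      ≡⟨ cong (_* 3) ∑𝟙T≡13 ⟩
    39 ∎
    where open ≡-Reasoning

  counts : n₇ * 2 + n₄ ≡ 7 × n₁ ≡ 11 + n₇
  counts = vertex-counts n₁+n₄+n₇≡18 n₁+n₄*4+n₇*7≡39

  degrees-of-α₁ : ∀ y → αAt D y ≡ 1 → degree 𝟙T y ≡ 1 × degree 𝟙Q y ≡ 5
  degrees-of-α₁ y α≡1 = trans (sym (αAt≡degree y)) α≡1
                      , profile-1 (subst (λ a → Profile a (degree 𝟙Q y)) α≡1 (profileAt y))

  j : Fin (length D) → ℕ
  j = weight (c 1)

  ∑-*j : ∀ f k → (∀ y → αAt D y ≡ 1 → degree f y ≡ k) → ∑[ i < length D ] (f i * j i) ≡ n₁ * k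
  ∑-*j f k on-α₁ = begin
    ∑[ i < length D ] (f i * j i)      ≡⟨ ∑-weight f (c 1) ⟩
    ∑[ y < 18 ] (c 1 y * degree f y)   ≡⟨ ∑-𝟙*-cong (λ y → αAt D y ≟ℕ 1) on-α₁ ⟩
    ∑[ y < 18 ] (c 1 y * k)            ≡⟨ sym (*-distribʳ-sum k (c 1)) ⟩
    n₁ * k                             ∎
    where open ≡-Reasoning

  degree-j-of-α₁ : ∀ y → αAt D y ≡ 1 → degree j y ≡ n₁ + 5
  degree-j-of-α₁ y α≡1 = +-cancelʳ-≡ 1 _ _ (begin
    degree j y + 1       ≡⟨ cong (degree j y +_) (sym c₁≡1) ⟩
    degree j y + c 1 y   ≡⟨ ∑-through y (c 1) ⟩
    n₁ + r y * c 1 y     ≡⟨ cong₂ (λ a b → n₁ + a * b) r≡6 c₁≡1 ⟩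
    n₁ + 6               ≡⟨ sym (+-assoc n₁ 5 1) ⟩
    n₁ + 5 + 1           ∎)
    where
    open ≡-Reasoning
    c₁≡1 : c 1 y ≡ 1
    c₁≡1 = 𝟙-yes (αAt D y ≟ℕ 1) α≡1
    r≡6 : r y ≡ 6
    r≡6 = trans (r-split y) (cong₂ _+_ (proj₁ (degrees-of-α₁ y α≡1)) (proj₂ (degrees-of-α₁ y α≡1)))

  module Vertex₇ (x : Fin 18) (α≡7 : αAt D x ≡ 7) where

    c₁≡0 : c 1 x ≡ 0
    c₁≡0 = 𝟙-no (αAt D x ≟ℕ 1) (λ α≡1 → case trans (sym α≡7) α≡1 of λ ())

    degree-j : degree j x ≡ n₁
    degree-j = begin
      degree j x                ≡⟨ sym (+-identityʳ (degree j x)) ⟩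
      degree j x + 0            ≡⟨ cong (degree j x +_) (sym c₁≡0) ⟩
      degree j x + c 1 x        ≡⟨ ∑-through x (c 1) ⟩
      n₁ + r x * c 1 x          ≡⟨ cong (λ k → n₁ + r x * k) c₁≡0 ⟩
      n₁ + r x * 0              ≡⟨ cong (n₁ +_) (*-zeroʳ (r x)) ⟩
      n₁ + 0                    ≡⟨ +-identityʳ n₁ ⟩
      n₁                        ∎
      where open ≡-Reasoning

    degree-𝟙T : degree 𝟙T x ≡ 7
    degree-𝟙T = trans (sym (αAt≡degree x)) α≡7

    degree-𝟙Q : degree 𝟙Q x ≡ 1
    degree-𝟙Q = profile-7 (subst (λ a → Profile a (degree 𝟙Q x)) α≡7 (profileAt x))

    j+χ≤length : ∀ i → j i + χ i x ≤ length (verts (lookup D i))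
    j+χ≤length i = begin
      j i + χ i x                                    ≡⟨ cong (j i +_) (sym (∑-δ x (χ i))) ⟩
      weight (c 1) i + weight (λ y → 𝟙 (y ≟ x)) i    ≡⟨ sym (weight-+ (c 1) (λ y → 𝟙 (y ≟ x)) i) ⟩
      weight (λ y → c 1 y + 𝟙 (y ≟ x)) i             ≤⟨ weight-mono i at-most-one ⟩
      size i                                         ≡⟨ size≡length i ⟩
      length (verts (lookup D i))                    ∎
      where
      open ≤-Reasoning
      at-most-one : ∀ y → c 1 y + 𝟙 (y ≟ x) ≤ 1
      at-most-one y with y ≟ x
      ... | yes refl = subst (λ k → k + 1 ≤ 1) (sym c₁≡0) ≤-refl
      ... | no _     = subst (_≤ 1) (sym (+-identityʳ (c 1 y))) (𝟙≤1 (αAt D y ≟ℕ 1))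

    LHS RHS : Fin (length D) → ℕ
    LHS i = 𝟙T i * j i + 𝟙Q i * j i * 7 + j i * χ i x * 2
    RHS i = j i * j i + 𝟙Q i * 12 + (𝟙T i * 2 + 𝟙Q i * 6) * χ i x

    ∑LHS : sum LHS ≡ n₁ * 38
    ∑LHS = begin
      sum LHS
        ≡⟨ ∑-distrib-+ (λ i → 𝟙T i * j i + 𝟙Q i * j i * 7) (λ i → j i * χ i x * 2) ⟩
      ∑[ i < length D ] (𝟙T i * j i + 𝟙Q i * j i * 7) + ∑[ i < length D ] (j i * χ i x * 2)
        ≡⟨ cong (_+ ∑[ i < length D ] (j i * χ i x * 2))
                (∑-distrib-+ (λ i → 𝟙T i * j i) (λ i → 𝟙Q i * j i * 7)) ⟩
      ∑[ i < length D ] (𝟙T i * j i) + ∑[ i < length D ] (𝟙Q i * j i * 7) + ∑[ i < length D ] (j i * χ i x * 2)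
        ≡⟨ cong₂ (λ a b → ∑[ i < length D ] (𝟙T i * j i) + a + b)
                 (sym (*-distribʳ-sum 7 (λ i → 𝟙Q i * j i))) (sym (*-distribʳ-sum 2 (λ i → j i * χ i x))) ⟩
      ∑[ i < length D ] (𝟙T i * j i) + ∑[ i < length D ] (𝟙Q i * j i) * 7 + degree j x * 2
        ≡⟨ cong₂ (λ a b → a + b * 7 + degree j x * 2) (∑-*j 𝟙T 1 (λ y → proj₁ ∘ degrees-of-α₁ y))
                                                       (∑-*j 𝟙Q 5 (λ y → proj₂ ∘ degrees-of-α₁ y)) ⟩
      n₁ * 1 + n₁ * 5 * 7 + degree j x * 2
        ≡⟨ cong (λ a → n₁ * 1 + n₁ * 5 * 7 + a * 2) degree-j ⟩
      n₁ * 1 + n₁ * 5 * 7 + n₁ * 2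
        ≡⟨ rearrange n₁ ⟩
      n₁ * 38
        ∎
      where
      open ≡-Reasoning
      rearrange : ∀ s → s * 1 + s * 5 * 7 + s * 2 ≡ s * 38
      rearrange = solve-∀

    ∑RHS : sum RHS ≡ n₁ * (n₁ + 5) + 248
    ∑RHS = begin
      sum RHS
        ≡⟨ ∑-distrib-+ (λ i → j i * j i + 𝟙Q i * 12) (λ i → (𝟙T i * 2 + 𝟙Q i * 6) * χ i x) ⟩
      ∑[ i < length D ] (j i * j i + 𝟙Q i * 12) + degree (λ i → 𝟙T i * 2 + 𝟙Q i * 6) x
        ≡⟨ cong₂ _+_ (∑-distrib-+ (λ i → j i * j i) (λ i → 𝟙Q i * 12)) (degree-linear 𝟙T 𝟙Q 2 6 x) ⟩
      ∑[ i < length D ] (j i * j i) + ∑[ i < length D ] (𝟙Q i * 12) + (degree 𝟙T x * 2 + degree 𝟙Q x * 6)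
        ≡⟨ cong₂ (λ a b → a + b + (degree 𝟙T x * 2 + degree 𝟙Q x * 6))
                 (∑-*j j (n₁ + 5) degree-j-of-α₁) (trans (sym (*-distribʳ-sum 12 𝟙Q)) ∑𝟙Q*12≡228) ⟩
      n₁ * (n₁ + 5) + 228 + (degree 𝟙T x * 2 + degree 𝟙Q x * 6)
        ≡⟨ cong₂ (λ a b → n₁ * (n₁ + 5) + 228 + (a * 2 + b * 6)) degree-𝟙T degree-𝟙Q ⟩
      n₁ * (n₁ + 5) + 228 + 20
        ≡⟨ +-assoc (n₁ * (n₁ + 5)) 228 20 ⟩
      n₁ * (n₁ + 5) + 248
        ∎
      where open ≡-Reasoning

    impossible : ⊥
    impossible = quadratic-bound-fails (proj₁ counts) (proj₂ counts) 1≤n₇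
                   (subst₂ _≤_ ∑LHS ∑RHS (∑-mono-≤ LHS≤RHS))
      where
      LHS≤RHS : ∀ i → LHS i ≤ RHS i
      LHS≤RHS i = block-bound (lookup D i) (j i) (χ i x) (j+χ≤length i)
      1≤n₇ : 1 ≤ n₇
      1≤n₇ = subst (_≤ n₇) (𝟙-yes (αAt D x ≟ℕ 7) α≡7) (term≤∑ (c 7) x)

  α≢7 : ∀ x → αAt D x ≢ 7
  α≢7 = Vertex₇.impossible

  n₇≡0 : n₇ ≡ 0
  n₇≡0 = sum-cong-≗ (λ y → 𝟙-no (αAt D y ≟ℕ 7) (α≢7 y))

  n₄≡7 : n₄ ≡ 7
  n₄≡7 = subst (λ b → b * 2 + n₄ ≡ 7) n₇≡0 (proj₁ counts)

  n₁≡11 : n₁ ≡ 11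
  n₁≡11 = subst (λ b → n₁ ≡ 11 + b) n₇≡0 (proj₂ counts)

  W : List (Fin 18)
  W = filter (λ y → αAt D y ≟ℕ 4) (allFin 18)

  length-W : length W ≡ 7
  length-W = trans (length-filter-tabulate (λ y → αAt D y ≟ℕ 4) (λ y → y)) n₄≡7

  W-unique : Unique W
  W-unique = filter⁺ (λ y → αAt D y ≟ℕ 4) (allFin⁺ 18)

  ∈W⇒α≡4 : ∀ {y} → y ∈ W → αAt D y ≡ 4
  ∈W⇒α≡4 y∈W = proj₂ (∈-filter⁻ (λ y → αAt D y ≟ℕ 4) {xs = allFin 18} y∈W)

  ∉W⇒α≡1 : ∀ {y} → y ∉ W → αAt D y ≡ 1
  ∉W⇒α≡1 {y} y∉W = profile-≢4-≢7⇒≡1 (profileAt y) (y∉W ∘ ∈-filter⁺ (λ y → αAt D y ≟ℕ 4) (∈-allFin y)) (α≢7 y)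

  2≤triplesInside : 2 ≤ triplesInside D W
  2≤triplesInside = +-cancelʳ-≤ 11 2 (triplesInside D W) (begin
    13                                       ≡⟨ sym ∑𝟙T≡13 ⟩
    sum 𝟙T                                   ≤⟨ ∑-mono-≤ triple-bound ⟩
    ∑[ i < length D ] (inside i + 𝟙T i * j i) ≡⟨ ∑-distrib-+ inside (λ i → 𝟙T i * j i) ⟩
    sum inside + ∑[ i < length D ] (𝟙T i * j i)
      ≡⟨ cong₂ _+_ (sym (length-filter-lookup (tripleInside? W) D))
                   (trans (∑-*j 𝟙T 1 (λ y → proj₁ ∘ degrees-of-α₁ y)) (cong (_* 1) n₁≡11)) ⟩
    triplesInside D W + 11                   ∎)
    where
    open ≤-Reasoning
    inside : Fin (length D) → ℕ
    inside i = 𝟙 (tripleInside? W (lookup D i))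
    meets-α₁ : ∀ i → ¬ All (_∈ W) (verts (lookup D i)) → 1 ≤ j i
    meets-α₁ i ¬⊆W with find (¬All⇒Any¬ (_∈? W) _ ¬⊆W)
    ... | z , z∈b , z∉W = subst (_≤ j i) (𝟙-yes (αAt D z ≟ℕ 1) (∉W⇒α≡1 z∉W)) (weight-≥ (c 1) z∈b)
    triple-bound : ∀ i → 𝟙T i ≤ inside i + 𝟙T i * j i
    triple-bound i = 𝟙≤𝟙×+𝟙* (isTriple? (lookup D i)) (all? (_∈? W) (verts (lookup D i))) (λ _ → meets-α₁ i)

lemma17 : (D : List (Block 18)) → IsDecomposition 18 D → α D ≡ 13 →
          Σ (Fin 7 → Fin 18) (λ w →
            Injective _≡_ _≡_ w
            × (∀ i → αAt D (w i) ≡ 4)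
            × 2 ≤ triplesInside D (toList w))
lemma17 D (wf , E) α≡13 =
  let w , w-injective , w∈W , toList-w≡W = injection-from-list W length-W W-unique
  in  w , w-injective , ∈W⇒α≡4 ∘ w∈W , subst (λ ws → 2 ≤ triplesInside D ws) (sym toList-w≡W) 2≤triplesInside
  where open Decomposition₁₈ D wf E α≡13
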